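{- The subspace $\mathrm{span}_{\mathbb{Q}}\{\mathcal{I}^{\mathrm{reg}}\}$ spanned by regularizable integer indices is a $\mathbb{Q}$-subalgebra of $(\mathrm{span}_{\mathbb{Q}}\{\mathcal{I}\},\ast)$.
   Context: An integer index is a tuple $\mathbf{k}=(k_1,\dots,k_r)\in\mathbb{Z}^r$, $r\ge0$ ($\emptyset$ for $r=0$); $\mathcal{I}=\bigsqcup_{r\ge0}\mathbb{Z}^r$ and $\mathrm{span}_{\mathbb{Q}}\{S\}$ is the formal $\mathbb{Q}$-vector space with basis $S$. For $r\ge1$, $m_{\mathbf{k}}=\min_{1\le t\le r}\sum_{i=t}^r(k_i-1)$, and $m_\emptyset=\infty$; $\mathbf{k}$ is regularizable if $m_{\mathbf{k}}\ge0$, and $\mathcal{I}^{\mathrm{reg}}$ is the set of regularizable indices. The stuffle product $\ast$ is the bilinear product on $\mathrm{span}_{\mathbb{Q}}\{\mathcal{I}\}$ defined recursively by $\emptyset\ast\mathbf{k}=\mathbf{k}\ast\emptyset=\mathbf{k}$ and, for $\mathbf{k},\mathbf{k}'\in\mathcal{I}$, $k,k'\in\mathbb{Z}$, $(\mathbf{k},k)\ast(\mathbf{k}',k')=(\mathbf{k}\ast(\mathbf{k}',k'),k)+((\mathbf{k},k)\ast\mathbf{k}',k')+(\mathbf{k}\ast\mathbf{k}',k+k')$, where $(\mathbf{k},k)$ denotes concatenation and $(\Sigma,a)$ means appending $a$ to every index of $\Sigma$, extended linearly. -}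

module Defs where

open import Data.Integer using (ℤ; _+_; _-_; _⊓_; _≤_; 0ℤ; 1ℤ)
import Data.Integer.Properties as ℤP
open import Data.Rational using (ℚ; 0ℚ; 1ℚ) renaming (_+_ to _+ℚ_; _*_ to _*ℚ_)
import Data.Rational.Properties as ℚP
open import Data.List using (List; []; _∷_; _++_; map; concatMap)
open import Data.Product using (_×_; _,_)
open import Relation.Nullary using (Dec; yes; no; ¬_)
open import Relation.Binary.PropositionalEquality using (_≡_; refl; cong₂)

-- Integer indices k = (k₁,…,k_r), stored as snoc-lists so that the
-- last entry k_r is the outermost constructor:  (k , k_r) = k ▸ k_r.

infixl 5 _▸_
data Index : Set where
  ∅   : Index
  _▸_ : Index → ℤ → Index

▸-injective : ∀ {k l a b} → (k ▸ a) ≡ (l ▸ b) → (k ≡ l) × (a ≡ b)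
▸-injective refl = refl , refl

_≟ᵢ_ : (k l : Index) → Dec (k ≡ l)
∅ ≟ᵢ ∅ = yes refl
∅ ≟ᵢ (l ▸ b) = no (λ ())
(k ▸ a) ≟ᵢ ∅ = no (λ ())
(k ▸ a) ≟ᵢ (l ▸ b) with k ≟ᵢ l | a ℤP.≟ b
... | yes p | yes q = yes (cong₂ _▸_ p q)
... | no ¬p | _ = no (λ e → ¬p (Data.Product.proj₁ (▸-injective e)))
... | yes _ | no ¬q = no (λ e → ¬q (Data.Product.proj₂ (▸-injective e)))

-- m_k = min_{1≤t≤r} Σ_{i=t}^r (k_i − 1), with m_∅ = ∞.

data ℤ∞ : Set where
  fin : ℤ → ℤ∞
  ∞   : ℤ∞

-- min(0, m): the empty suffix contributes 0 (m_∅ = ∞)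
min0 : ℤ∞ → ℤ
min0 (fin z) = 0ℤ ⊓ z
min0 ∞       = 0ℤ

-- suffix sums of (k , a) are (a−1) and (a−1) + (suffix sums of k), so
-- m_(k,a) = (a − 1) + min(0, m_k).
m : Index → ℤ∞
m ∅       = ∞
m (k ▸ a) = fin ((a - 1ℤ) + min0 (m k))

infix 4 _≤∞_
data _≤∞_ : ℤ → ℤ∞ → Set where
  ≤fin : ∀ {x z} → x ≤ z → x ≤∞ fin z
  ≤inf : ∀ {x} → x ≤∞ ∞

Regularizable : Index → Set
Regularizable k = 0ℤ ≤∞ m k

-- span_ℚ{I}: formal finite ℚ-linear combinations, represented by lists
-- of (coefficient , basis index); the vector they denote is given by
-- the coefficient function `coeff` (so lists are identified up to
-- collecting terms).

Lin : Set
Lin = List (ℚ × Index)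

coeff : Lin → Index → ℚ
coeff [] k = 0ℚ
coeff ((c , l) ∷ xs) k with l ≟ᵢ k
... | yes _ = c +ℚ coeff xs k
... | no  _ = coeff xs k

_⊕_ : Lin → Lin → Lin
x ⊕ y = x ++ y

_·_ : ℚ → Lin → Lin
c · x = map (λ { (d , k) → (c *ℚ d , k) }) x

one : Lin
one = (1ℚ , ∅) ∷ []

InRegSpan : Lin → Set
InRegSpan x = ∀ k → ¬ (coeff x k ≡ 0ℚ) → Regularizable k

appendAll : ℤ → List Index → List Index
appendAll a = map (_▸ a)

stuffleᵢ : Index → Index → List Index
stuffleᵢ ∅ l = l ∷ []
stuffleᵢ (k ▸ a) ∅ = (k ▸ a) ∷ []
stuffleᵢ (k ▸ a) (l ▸ b) =
  appendAll a (stuffleᵢ k (l ▸ b))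
  ++ appendAll b (stuffleᵢ (k ▸ a) l)
  ++ appendAll (a + b) (stuffleᵢ k l)

_∗_ : Lin → Lin → Lin
x ∗ y = concatMap (λ { (c , k) →
          concatMap (λ { (d , l) →
            map (λ n → (c *ℚ d , n)) (stuffleᵢ k l) }) y }) x

{-# OPTIONS --safe #-}
-- Put m⁻ k = min(0, m_k), so that k is regularizable iff m⁻ k ≥ 0.  Every index n
-- occurring in the stuffle k ∗ l satisfies m⁻ k + m⁻ l ≤ m⁻ n: induct along the
-- recursive definition, using m_(k,a) = (a − 1) + m⁻ k and, for the merged last
-- entry, (a + b) − 1 = (a − 1) + (b − 1) + 1.  Hence stuffles of regularizable
-- indices are regularizable, and it remains to check that this survives bilinear
-- extension to formal combinations, which are lists identified up to collecting terms.
module Submission where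

open import Defs
open import Data.Rational using (ℚ; 0ℚ; 1ℚ; _+_; _*_; _≟_)
open import Data.Product using (_×_; _,_)
open import Data.Integer as ℤ using (ℤ; 0ℤ; 1ℤ)
import Data.Integer.Properties as ℤP
open import Data.Integer.Solver using (module +-*-Solver)
import Data.Rational.Properties as ℚP
import Data.Rational.Solver as ℚSolver
open import Data.List using (List; []; _∷_; map; concatMap)
open import Data.List.Relation.Unary.All as All using (All; []; _∷_)
import Data.List.Relation.Unary.All.Properties as AllP
open import Relation.Nullary using (Dec; yes; no; ¬_)
open import Relation.Nullary.Decidable using (map′)
open import Relation.Binary.PropositionalEquality
open import Data.Empty using (⊥-elim)

m⁻ : Index → ℤ
m⁻ k = min0 (m k)

m⁻≤0 : ∀ k → m⁻ k ℤ.≤ 0ℤ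
m⁻≤0 ∅       = ℤP.≤-refl
m⁻≤0 (k ▸ a) = ℤP.i⊓j≤i 0ℤ _

regularizable⇒0≤m⁻ : ∀ {k} → Regularizable k → 0ℤ ℤ.≤ m⁻ k
regularizable⇒0≤m⁻ {k} r with m k | r
... | fin z | ≤fin 0≤z = ℤP.⊓-glb ℤP.≤-refl 0≤z
... | ∞     | ≤inf     = ℤP.≤-refl

0≤m⁻⇒regularizable : ∀ {k} → 0ℤ ℤ.≤ m⁻ k → Regularizable k
0≤m⁻⇒regularizable {k} 0≤m⁻ with m k
... | fin z = ≤fin (ℤP.≤-trans 0≤m⁻ (ℤP.i⊓j≤j 0ℤ z))
... | ∞     = ≤inf

regularizable? : ∀ k → Dec (Regularizable k)
regularizable? k = map′ 0≤m⁻⇒regularizable regularizable⇒0≤m⁻ (0ℤ ℤ.≤? m⁻ k)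

module _ where
  open ℤP.≤-Reasoning

  m⁻-▸-+ : ∀ {k n} a {y} → y ℤ.≤ 0ℤ → m⁻ k ℤ.+ y ℤ.≤ m⁻ n →
           m⁻ (k ▸ a) ℤ.+ y ℤ.≤ m⁻ (n ▸ a)
  m⁻-▸-+ {k} {n} a {y} y≤0 hyp = ℤP.⊓-glb
    (ℤP.+-mono-≤ (ℤP.i⊓j≤i 0ℤ x) y≤0)
    (begin
      m⁻ (k ▸ a) ℤ.+ y             ≤⟨ ℤP.+-monoˡ-≤ y (ℤP.i⊓j≤j 0ℤ x) ⟩
      x ℤ.+ y                       ≡⟨ ℤP.+-assoc (a ℤ.- 1ℤ) (m⁻ k) y ⟩
      (a ℤ.- 1ℤ) ℤ.+ (m⁻ k ℤ.+ y) ≤⟨ ℤP.+-monoʳ-≤ (a ℤ.- 1ℤ) hyp ⟩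
      (a ℤ.- 1ℤ) ℤ.+ m⁻ n         ∎)
    where x = (a ℤ.- 1ℤ) ℤ.+ m⁻ k

  m⁻-+-▸ : ∀ {l n} b {x} → x ℤ.≤ 0ℤ → x ℤ.+ m⁻ l ℤ.≤ m⁻ n →
           x ℤ.+ m⁻ (l ▸ b) ℤ.≤ m⁻ (n ▸ b)
  m⁻-+-▸ {l} {n} b {x} x≤0 hyp =
    subst (ℤ._≤ m⁻ (n ▸ b)) (ℤP.+-comm (m⁻ (l ▸ b)) x)
      (m⁻-▸-+ {l} {n} b x≤0 (subst (ℤ._≤ m⁻ n) (ℤP.+-comm x (m⁻ l)) hyp))

  m⁻-▸-▸ : ∀ {k l n} a b → m⁻ k ℤ.+ m⁻ l ℤ.≤ m⁻ n →
           m⁻ (k ▸ a) ℤ.+ m⁻ (l ▸ b) ℤ.≤ m⁻ (n ▸ (a ℤ.+ b))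
  m⁻-▸-▸ {k} {l} {n} a b hyp = ℤP.⊓-glb
    (ℤP.+-mono-≤ (ℤP.i⊓j≤i 0ℤ x) (ℤP.i⊓j≤i 0ℤ y))
    (begin
      m⁻ (k ▸ a) ℤ.+ m⁻ (l ▸ b)              ≤⟨ ℤP.+-mono-≤ (ℤP.i⊓j≤j 0ℤ x) (ℤP.i⊓j≤j 0ℤ y) ⟩
      x ℤ.+ y                                 ≤⟨ ℤP.i≤i+j (x ℤ.+ y) 1ℤ ⟩
      x ℤ.+ y ℤ.+ 1ℤ                          ≡⟨ regroup a b (m⁻ k) (m⁻ l) ⟩
      ((a ℤ.+ b) ℤ.- 1ℤ) ℤ.+ (m⁻ k ℤ.+ m⁻ l) ≤⟨ ℤP.+-monoʳ-≤ ((a ℤ.+ b) ℤ.- 1ℤ) hyp ⟩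
      ((a ℤ.+ b) ℤ.- 1ℤ) ℤ.+ m⁻ n            ∎)
    where
    x = (a ℤ.- 1ℤ) ℤ.+ m⁻ k
    y = (b ℤ.- 1ℤ) ℤ.+ m⁻ l
    regroup : ∀ a b u v → ((a ℤ.- 1ℤ) ℤ.+ u) ℤ.+ ((b ℤ.- 1ℤ) ℤ.+ v) ℤ.+ 1ℤ
                          ≡ ((a ℤ.+ b) ℤ.- 1ℤ) ℤ.+ (u ℤ.+ v)
    regroup = solve 4 (λ a b u v → ((a :- con 1ℤ) :+ u) :+ ((b :- con 1ℤ) :+ v) :+ con 1ℤ
                                   := ((a :+ b) :- con 1ℤ) :+ (u :+ v)) refl
      where open +-*-Solver

stuffle-m⁻ : ∀ k l → All (λ n → m⁻ k ℤ.+ m⁻ l ℤ.≤ m⁻ n) (stuffleᵢ k l)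
stuffle-m⁻ ∅       l       = ℤP.≤-reflexive (ℤP.+-identityˡ (m⁻ l)) ∷ []
stuffle-m⁻ (k ▸ a) ∅       = ℤP.≤-reflexive (ℤP.+-identityʳ (m⁻ (k ▸ a))) ∷ []
stuffle-m⁻ (k ▸ a) (l ▸ b) =
  AllP.++⁺ (AllP.map⁺ (All.map (λ {n} → m⁻-▸-+ {k} {n} a (m⁻≤0 (l ▸ b)))
                               (stuffle-m⁻ k (l ▸ b))))
  (AllP.++⁺ (AllP.map⁺ (All.map (λ {n} → m⁻-+-▸ {l} {n} b (m⁻≤0 (k ▸ a)))
                                (stuffle-m⁻ (k ▸ a) l)))
            (AllP.map⁺ (All.map (λ {n} → m⁻-▸-▸ {k} {l} {n} a b)
                                (stuffle-m⁻ k l))))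

stuffle-regularizable : ∀ {k l} → Regularizable k → Regularizable l →
                        All Regularizable (stuffleᵢ k l)
stuffle-regularizable {k} {l} rk rl = All.map
  (λ hyp → 0≤m⁻⇒regularizable (ℤP.≤-trans
    (ℤP.+-mono-≤ (regularizable⇒0≤m⁻ rk) (regularizable⇒0≤m⁻ rl)) hyp))
  (stuffle-m⁻ k l)

⟨_,_⟩ : Lin → (Index → ℚ) → ℚ
⟨ []          , F ⟩ = 0ℚ
⟨ (c , k) ∷ x , F ⟩ = c * F k + ⟨ x , F ⟩

zeroAt : Index → (Index → ℚ) → Index → ℚ
zeroAt k F j with j ≟ᵢ k
... | yes _ = 0ℚ
... | no  _ = F j

zeroAt-self : ∀ k F → zeroAt k F k ≡ 0ℚ
zeroAt-self k F with k ≟ᵢ k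
... | yes _   = refl
... | no  k≢k = ⊥-elim (k≢k refl)

coeff-∷-≢ : ∀ {c k j} x → ¬ k ≡ j → coeff ((c , k) ∷ x) j ≡ coeff x j
coeff-∷-≢ {k = k} {j} x k≢j with k ≟ᵢ j
... | yes k≡j = ⊥-elim (k≢j k≡j)
... | no  _   = refl

⟨⟩-split : ∀ k x F → ⟨ x , F ⟩ ≡ coeff x k * F k + ⟨ x , zeroAt k F ⟩
⟨⟩-split k [] F = solve 1 (λ f → con 0ℚ := con 0ℚ :* f :+ con 0ℚ) refl (F k)
  where open ℚSolver.+-*-Solver
⟨⟩-split k ((c , l) ∷ x) F with l ≟ᵢ k
... | yes refl = begin
  c * F l + ⟨ x , F ⟩
    ≡⟨ cong (c * F l +_) (⟨⟩-split l x F) ⟩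
  c * F l + (coeff x l * F l + ⟨ x , zeroAt l F ⟩)
    ≡⟨ solve 4 (λ c a f r → c :* f :+ (a :* f :+ r) := (c :+ a) :* f :+ (c :* con 0ℚ :+ r))
               refl c (coeff x l) (F l) ⟨ x , zeroAt l F ⟩ ⟩
  (c + coeff x l) * F l + (c * 0ℚ + ⟨ x , zeroAt l F ⟩) ∎
  where open ℚSolver.+-*-Solver; open ≡-Reasoning
... | no _ = begin
  c * F l + ⟨ x , F ⟩
    ≡⟨ cong (c * F l +_) (⟨⟩-split k x F) ⟩
  c * F l + (coeff x k * F k + ⟨ x , zeroAt k F ⟩)
    ≡⟨ solve 5 (λ c f a g r → c :* f :+ (a :* g :+ r) := a :* g :+ (c :* f :+ r))
               refl c (F l) (coeff x k) (F k) ⟨ x , zeroAt k F ⟩ ⟩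
  coeff x k * F k + (c * F l + ⟨ x , zeroAt k F ⟩) ∎
  where open ℚSolver.+-*-Solver; open ≡-Reasoning

-- Splitting off the collected coefficient at the head index k lets the induction
-- continue on the tail with F zeroed at k.
⟨⟩-vanishes : ∀ x F → (∀ k → coeff x k * F k ≡ 0ℚ) → ⟨ x , F ⟩ ≡ 0ℚ
⟨⟩-vanishes []              F hyp = refl
⟨⟩-vanishes x@((c , k) ∷ y) F hyp = begin
  ⟨ x , F ⟩
    ≡⟨ ⟨⟩-split k x F ⟩
  coeff x k * F k + (c * zeroAt k F k + ⟨ y , zeroAt k F ⟩)
    ≡⟨ cong₂ (λ u v → u + (c * v + ⟨ y , zeroAt k F ⟩)) (hyp k) (zeroAt-self k F) ⟩
  0ℚ + (c * 0ℚ + ⟨ y , zeroAt k F ⟩)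
    ≡⟨ cong (λ v → 0ℚ + (c * 0ℚ + v)) (⟨⟩-vanishes y (zeroAt k F) hyp′) ⟩
  0ℚ + (c * 0ℚ + 0ℚ)
    ≡⟨ cong (λ v → 0ℚ + (v + 0ℚ)) (ℚP.*-zeroʳ c) ⟩
  0ℚ ∎
  where
  open ≡-Reasoning
  hyp′ : ∀ j → coeff y j * zeroAt k F j ≡ 0ℚ
  hyp′ j with j ≟ᵢ k
  ... | yes _   = ℚP.*-zeroʳ (coeff y j)
  ... | no  j≢k = trans (cong (_* F j) (sym (coeff-∷-≢ y (λ k≡j → j≢k (sym k≡j))))) (hyp j)

⟨⟩-*ˡ : ∀ c x F → ⟨ x , (λ k → c * F k) ⟩ ≡ c * ⟨ x , F ⟩
⟨⟩-*ˡ c []            F = sym (ℚP.*-zeroʳ c)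
⟨⟩-*ˡ c ((d , k) ∷ x) F = begin
  d * (c * F k) + ⟨ x , (λ k → c * F k) ⟩
    ≡⟨ cong (d * (c * F k) +_) (⟨⟩-*ˡ c x F) ⟩
  d * (c * F k) + c * ⟨ x , F ⟩
    ≡⟨ solve 4 (λ c d f r → d :* (c :* f) :+ c :* r := c :* (d :* f :+ r))
               refl c d (F k) ⟨ x , F ⟩ ⟩
  c * (d * F k + ⟨ x , F ⟩) ∎
  where open ℚSolver.+-*-Solver; open ≡-Reasoning

coeff-⊕ : ∀ x y k → coeff (x ⊕ y) k ≡ coeff x k + coeff y k
coeff-⊕ []            y k = sym (ℚP.+-identityˡ (coeff y k))
coeff-⊕ ((c , l) ∷ x) y k with l ≟ᵢ k
... | yes _ = trans (cong (c +_) (coeff-⊕ x y k)) (sym (ℚP.+-assoc c (coeff x k) (coeff y k)))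
... | no  _ = coeff-⊕ x y k

coeff-· : ∀ c x k → coeff (c · x) k ≡ c * coeff x k
coeff-· c []            k = sym (ℚP.*-zeroʳ c)
coeff-· c ((d , l) ∷ x) k with l ≟ᵢ k
... | yes _ = trans (cong (c * d +_) (coeff-· c x k)) (sym (ℚP.*-distribˡ-+ c d (coeff x k)))
... | no  _ = coeff-· c x k

multiplicity : Index → List Index → ℚ
multiplicity n []      = 0ℚ
multiplicity n (l ∷ L) with l ≟ᵢ n
... | yes _ = 1ℚ + multiplicity n L
... | no  _ = multiplicity n L

multiplicity-∉ : ∀ {n} L → All (λ l → ¬ l ≡ n) L → multiplicity n L ≡ 0ℚ
multiplicity-∉         []      []           = refl
multiplicity-∉ {n} (l ∷ L) (l≢n ∷ L≢n) with l ≟ᵢ n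
... | yes l≡n = ⊥-elim (l≢n l≡n)
... | no  _   = multiplicity-∉ L L≢n

coeff-map : ∀ e L n → coeff (map (λ l → (e , l)) L) n ≡ e * multiplicity n L
coeff-map e []      n = sym (ℚP.*-zeroʳ e)
coeff-map e (l ∷ L) n with l ≟ᵢ n
... | yes _ = trans (cong (e +_) (coeff-map e L n))
                (solve 2 (λ e r → e :+ e :* r := e :* (con 1ℚ :+ r)) refl e (multiplicity n L))
  where open ℚSolver.+-*-Solver
... | no  _ = coeff-map e L n

coeff-concatMap : ∀ (f : ℚ × Index → Lin) F x n → (∀ c k → coeff (f (c , k)) n ≡ c * F k) →
                  coeff (concatMap f x) n ≡ ⟨ x , F ⟩
coeff-concatMap f F []            n hyp = refl
coeff-concatMap f F ((c , k) ∷ x) n hyp =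
  trans (coeff-⊕ (f (c , k)) (concatMap f x) n)
        (cong₂ _+_ (hyp c k) (coeff-concatMap f F x n hyp))

coeff-∗ : ∀ x y n → coeff (x ∗ y) n ≡ ⟨ x , (λ k → ⟨ y , (λ l → multiplicity n (stuffleᵢ k l)) ⟩) ⟩
coeff-∗ x y n = coeff-concatMap _ _ x n λ c k →
  trans (coeff-concatMap _ _ y n (λ d l →
           trans (coeff-map (c * d) (stuffleᵢ k l) n)
                 (solve 3 (λ c d r → (c :* d) :* r := d :* (c :* r))
                          refl c d (multiplicity n (stuffleᵢ k l)))))
        (⟨⟩-*ˡ c y (λ l → multiplicity n (stuffleᵢ k l)))
  where open ℚSolver.+-*-Solver

InRegSpan⇒coeff≡0 : ∀ x {k} → InRegSpan x → ¬ Regularizable k → coeff x k ≡ 0ℚ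
InRegSpan⇒coeff≡0 x {k} hx ¬rk with coeff x k ≟ 0ℚ
... | yes x≡0 = x≡0
... | no  x≢0 = ⊥-elim (¬rk (hx k x≢0))

coeff≡0⇒InRegSpan : ∀ x → (∀ k → ¬ Regularizable k → coeff x k ≡ 0ℚ) → InRegSpan x
coeff≡0⇒InRegSpan x hyp k x≢0 with regularizable? k
... | yes rk  = rk
... | no  ¬rk = ⊥-elim (x≢0 (hyp k ¬rk))

InRegSpan⇒⟨⟩≡0 : ∀ x F → InRegSpan x → (∀ k → Regularizable k → F k ≡ 0ℚ) → ⟨ x , F ⟩ ≡ 0ℚ
InRegSpan⇒⟨⟩≡0 x F hx hF = ⟨⟩-vanishes x F vanish
  where
  vanish : ∀ k → coeff x k * F k ≡ 0ℚ
  vanish k with regularizable? k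
  ... | yes rk  = trans (cong (coeff x k *_) (hF k rk)) (ℚP.*-zeroʳ (coeff x k))
  ... | no  ¬rk = trans (cong (_* F k) (InRegSpan⇒coeff≡0 x hx ¬rk)) (ℚP.*-zeroˡ (F k))

InRegSpan-one : InRegSpan one
InRegSpan-one k 1≢0 with ∅ ≟ᵢ k
... | yes refl = ≤inf
... | no  _    = ⊥-elim (1≢0 refl)

InRegSpan-⊕ : ∀ x y → InRegSpan x → InRegSpan y → InRegSpan (x ⊕ y)
InRegSpan-⊕ x y hx hy = coeff≡0⇒InRegSpan (x ⊕ y) λ k ¬rk →
  trans (coeff-⊕ x y k) (cong₂ _+_ (InRegSpan⇒coeff≡0 x hx ¬rk) (InRegSpan⇒coeff≡0 y hy ¬rk))

InRegSpan-· : ∀ c x → InRegSpan x → InRegSpan (c · x)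
InRegSpan-· c x hx = coeff≡0⇒InRegSpan (c · x) λ k ¬rk →
  trans (coeff-· c x k) (trans (cong (c *_) (InRegSpan⇒coeff≡0 x hx ¬rk)) (ℚP.*-zeroʳ c))

InRegSpan-∗ : ∀ x y → InRegSpan x → InRegSpan y → InRegSpan (x ∗ y)
InRegSpan-∗ x y hx hy = coeff≡0⇒InRegSpan (x ∗ y) λ n ¬rn →
  trans (coeff-∗ x y n)
    (InRegSpan⇒⟨⟩≡0 x _ hx λ k rk →
       InRegSpan⇒⟨⟩≡0 y _ hy λ l rl →
         multiplicity-∉ (stuffleᵢ k l)
           (All.map (λ rm m≡n → ¬rn (subst Regularizable m≡n rm)) (stuffle-regularizable rk rl)))

corollary5p5 : InRegSpan one
    × (∀ x y → InRegSpan x → InRegSpan y → InRegSpan (x ⊕ y))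
    × (∀ (c : ℚ) x → InRegSpan x → InRegSpan (c · x))
    × (∀ x y → InRegSpan x → InRegSpan y → InRegSpan (x ∗ y))
corollary5p5 = InRegSpan-one , InRegSpan-⊕ , InRegSpan-· , InRegSpan-∗
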